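{- Let $G=(V,E,w)$ be a connected graph with $n$ vertices and let $T$ be a spanning tree of $G$ with root $r$. For distinct $e,f\in E(T)$, if $\mathrm{cut}(e,f)$ is trivial then: (1) if $e,f$ are independent, then they must be the unique edges incident to the root (i.e. $e$ and $f$ are both incident to $r$ and $r$ has no other incident tree edges); (2) if $e,f$ are descendant, then there is a vertex $v\in V$ such that $e$ is the edge incoming to $v$ and $f$ is the unique edge outgoing from $v$, or vice versa.
   Context: $G$ is undirected with positive edge weights; $\Delta(S)$ is the set of edges with exactly one endpoint in $S$. $T$ is viewed as directed with all edges directed away from $r$. For $e\in E(T)$, $e^\downarrow\subseteq V$ is the vertex set of the component of $T-e$ not containing $r$, and $T_e\subseteq E(T)$ is the set of edges of the subtree rooted at the head of $e$ (edges of $T$ with both endpoints in $e^\downarrow$). Edges $e,f\in E(T)$ are descendant if $f\in T_e$ or $e\in T_f$, and independent otherwise. If $f\in T_e$ then $\mathrm{cut}(e,f)=\Delta(e^\downarrow\setminus f^\downarrow)$ (symmetrically if $e\in T_f$); if $e,f$ are independent then $\mathrm{cut}(e,f)=\Delta(e^\downarrow\cup f^\downarrow)$. A cut $\Delta(S)$ is trivial if $|S|=1$ or $|V\setminus S|=1$, and non-trivial otherwise. -}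

module Defs where

open import Level using (0ℓ)
open import Data.Nat using (ℕ)
open import Data.Fin using (Fin)
open import Data.Product using (Σ; ∃; _×_; _,_)
open import Data.Sum using (_⊎_)
open import Function using (_⇔_)
open import Relation.Nullary using (¬_)
open import Relation.Binary.PropositionalEquality using (_≡_; _≢_)
open import Relation.Binary.Construct.Closure.ReflexiveTransitive using (Star)

VSet : ℕ → Set₁
VSet n = Fin n → Set

-- A simple undirected graph on the vertex set Fin n.
-- Adj u v means {u,v} ∈ E.  (Edge weights play no role in the statement.)
record Graph (n : ℕ) : Set₁ where
  field
    Adj     : Fin n → Fin n → Set
    sym     : ∀ {u v} → Adj u v → Adj v u
    irrefl  : ∀ {u} → ¬ Adj u u

open Graph public

Connected : ∀ {n} → Graph n → Set
Connected G = ∀ u v → Star (Adj G) u v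

iter : ∀ {A : Set} → (A → A) → ℕ → A → A
iter f ℕ.zero    a = a
iter f (ℕ.suc k) a = f (iter f k a)

-- A spanning tree T of G rooted at r, directed away from r, given by its
-- parent map: the tree edges are (parent v , v) for v ≢ r; every such pair is
-- an edge of G, and every vertex reaches the root by following parents
-- (which makes the n-1 edges connected, hence a spanning tree).
-- A tree edge is identified with its head (child) vertex v ≢ r.
record RootedSpanningTree {n : ℕ} (G : Graph n) (r : Fin n) : Set where
  field
    parent       : Fin n → Fin n
    parent-root  : parent r ≡ r
    tree-edge    : ∀ v → v ≢ r → Adj G (parent v) v
    reaches-root : ∀ v → ∃ λ k → iter parent k v ≡ r

open RootedSpanningTree public

module _ {n : ℕ} {G : Graph n} {r : Fin n} (T : RootedSpanningTree G r) where

  -- e↓ for the tree edge with head x: all vertices whose ancestor chain hits x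
  down : Fin n → VSet n
  down x u = ∃ λ k → iter (parent T) k u ≡ x

  -- f ∈ T_e  (f with head y, e with head x): both endpoints of f lie in e↓
  InSubtree : Fin n → Fin n → Set
  InSubtree y x = down x (parent T y) × down x y

  Descendant : Fin n → Fin n → Set
  Descendant x y = InSubtree y x ⊎ InSubtree x y

  Independent : Fin n → Fin n → Set
  Independent x y = ¬ Descendant x y

  -- IsCutSide x y S : cut(e,f) = Δ(S), as in the definition of cut(e,f)
  data IsCutSide (x y : Fin n) : VSet n → Set₁ where
    desc₁ : InSubtree y x → IsCutSide x y (λ u → down x u × ¬ down y u)
    desc₂ : InSubtree x y → IsCutSide x y (λ u → down y u × ¬ down x u)
    indep : Independent x y → IsCutSide x y (λ u → down x u ⊎ down y u)

  Incident : Fin n → Fin n → Set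
  Incident u v = parent T v ≡ u ⊎ v ≡ u

-- Δ(S) as a predicate on (ordered representations of) edges of G
Δ : ∀ {n} → Graph n → VSet n → Fin n → Fin n → Set
Δ G S u v = Adj G u v × ((S u × ¬ S v) ⊎ (¬ S u × S v))

SameEdgeSet : ∀ {n} → Graph n → (Fin n → Fin n → Set) → (Fin n → Fin n → Set) → Set
SameEdgeSet G C D = ∀ u v → Adj G u v → (C u v ⇔ D u v)

Singleton : ∀ {n} → VSet n → Set
Singleton S = ∃ λ x → ∀ y → (S y ⇔ y ≡ x)

CoSingleton : ∀ {n} → VSet n → Set
CoSingleton S = ∃ λ x → ∀ y → ((¬ S y) ⇔ y ≡ x)

TrivialCut : ∀ {n} → Graph n → (Fin n → Fin n → Set) → Set₁
TrivialCut G C = Σ (VSet _) λ S → SameEdgeSet G C (Δ G S) × (Singleton S ⊎ CoSingleton S)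

{-# OPTIONS --safe #-}
module Submission where

-- A trivial cut Δ(S) in a connected graph forces S or its complement to have at most one
-- vertex, since Δ(S) determines S up to complement (propagate along paths from one vertex).
-- If e and f are descendant, say f below e, then S = e↓ ∖ f↓ contains the head x of e and
-- avoids the root and the head of f, so S = {x}: then the tail of f is x, and any other child
-- of x would lie in S as well. If e and f are independent, S = e↓ ∪ f↓ contains both heads and
-- avoids r, so S = V ∖ {r}: a parent of a head other than r would put one edge below the other,
-- and every child of r lies in e↓ or f↓, hence is one of the two heads.

open import Defs hiding (sym)
open import Data.Nat using (ℕ; zero; suc; _+_; _*_; _∸_; _≤_; _<_; s≤s)
open import Data.Nat.Properties using (m≤m*n; m∸n+n≡m; ≰⇒>; <⇒≤; n<1+n; _≤?_; anyUpTo?)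
open import Data.Fin using (Fin)
open import Data.Fin.Properties using (_≟_)
open import Data.Product using (∃; _×_; _,_; proj₁; proj₂)
open import Data.Sum using (_⊎_; inj₁; inj₂; [_,_]; swap)
open import Data.Empty using (⊥-elim)
open import Function using (_∘_; id; _⇔_; mk⇔; Equivalence)
open import Relation.Nullary using (¬_; yes; no)
open import Relation.Nullary.Decidable using (decidable-stable; map′)
open import Relation.Unary using (Decidable; ∁; _∩_; _∪_; _⊆_)
open import Relation.Unary.Properties using (∁?; _∩?_; _∪?_)
open import Relation.Binary.PropositionalEquality using (_≡_; _≢_; refl; sym; trans; cong; subst; module ≡-Reasoning)
open import Relation.Binary.Construct.Closure.ReflexiveTransitive using (fold)

open Equivalence using (to; from)

Separates : {A : Set} → (A → Set) → A → A → Set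
Separates S u v = (S u × ¬ S v) ⊎ (¬ S u × S v)

AtMostOne : {A : Set} → (A → Set) → Set
AtMostOne S = ∃ λ a → ∀ u → S u → u ≡ a

module _ {A : Set} {S : A → Set} where

  ¬separates-inside : ∀ {u v} → S u → S v → ¬ Separates S u v
  ¬separates-inside su sv = [ (λ (_ , ¬sv) → ¬sv sv) , (λ (¬su , _) → ¬su su) ]

  ¬separates-outside : ∀ {u v} → ¬ S u → ¬ S v → ¬ Separates S u v
  ¬separates-outside ¬su ¬sv = [ (λ (su , _) → ¬su su) , (λ (_ , sv) → ¬sv sv) ]

  separates-∁ : Decidable S → ∀ {u v} → Separates S u v ⇔ Separates (∁ S) u v
  separates-∁ S? {u} {v} = mk⇔
    [ (λ (su , ¬sv) → inj₂ ((λ ¬su → ¬su su) , ¬sv)) , (λ (¬su , sv) → inj₁ (¬su , λ ¬sv → ¬sv sv)) ]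
    [ (λ (¬su , ¬¬sv) → inj₂ (¬su , stable v ¬¬sv)) , (λ (¬¬su , ¬sv) → inj₁ (stable u ¬¬su , ¬sv)) ]
    where
      stable : ∀ w → ¬ ¬ S w → S w
      stable w = decidable-stable (S? w)

  atMostOne-unique : AtMostOne S → ∀ {u v} → S u → S v → u ≡ v
  atMostOne-unique (a , only-a) {u} {v} su sv = trans (only-a u su) (sym (only-a v sv))

  atMostOne-⊆ : ∀ {P : A → Set} → P ⊆ S → AtMostOne S → AtMostOne P
  atMostOne-⊆ P⊆S (a , only-a) = a , λ u pu → only-a u (P⊆S pu)

module _ {n : ℕ} (G : Graph n) where

  Δ-∁ : ∀ {S S' : VSet n} → Decidable S →
        SameEdgeSet G (Δ G S) (Δ G S') → SameEdgeSet G (Δ G (∁ S)) (Δ G S')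
  Δ-∁ S? same u v uv = mk⇔
    (λ (_ , s) → to (same u v uv) (uv , from (separates-∁ S?) s))
    (λ d → uv , to (separates-∁ S?) (proj₂ (from (same u v uv) d)))

  -- Membership in S' is only known up to double negation, since S' need not be decidable.
  Agrees : VSet n → VSet n → VSet n
  Agrees S S' u = (S u → ¬ ¬ S' u) × (¬ S u → ¬ S' u)

  module Propagation (connected : Connected G) {S S' : VSet n} (S? : Decidable S)
                     (same : SameEdgeSet G (Δ G S) (Δ G S')) where

    separates-S⇒S' : ∀ {u v} → Adj G u v → Separates S u v → Separates S' u v
    separates-S⇒S' {u} {v} uv s = proj₂ (to (same u v uv) (uv , s))

    separates-S'⇒S : ∀ {u v} → Adj G u v → Separates S' u v → Separates S u v
    separates-S'⇒S {u} {v} uv s = proj₂ (from (same u v uv) (uv , s))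

    agrees-step : ∀ {u v} → Adj G u v → Agrees S S' u → Agrees S S' v
    agrees-step {u} uv (inside , outside) with S? u
    ... | yes su =
      (λ sv ¬s'v → inside su λ s'u → ¬separates-inside {S = S} su sv (separates-S'⇒S uv (inj₁ (s'u , ¬s'v)))) ,
      (λ ¬sv s'v → [ (λ (_ , ¬s'v) → ¬s'v s'v) , (λ (¬s'u , _) → inside su ¬s'u) ]
                     (separates-S⇒S' uv (inj₁ (su , ¬sv))))
    ... | no ¬su =
      (λ sv ¬s'v → [ (λ (s'u , _) → outside ¬su s'u) , (λ (_ , s'v) → ¬s'v s'v) ]
                     (separates-S⇒S' uv (inj₂ (¬su , sv)))) ,
      (λ ¬sv s'v → ¬separates-outside {S = S} ¬su ¬sv (separates-S'⇒S uv (inj₂ (outside ¬su , s'v))))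

    agrees-everywhere : ∀ {a} → Agrees S S' a → ∀ u → Agrees S S' u
    agrees-everywhere {a} agrees-a u =
      fold (λ v w → Agrees S S' v → Agrees S S' w) (λ vw f → f ∘ agrees-step vw) id (connected a u) agrees-a

    singleton-side : ∀ {a} → (∀ y → S' y ⇔ y ≡ a) → S a → AtMostOne S
    singleton-side {a} S'≡a sa = a , λ u su → decidable-stable (u ≟ a)
      λ u≢a → proj₁ (agrees-everywhere agrees-a u) su (u≢a ∘ to (S'≡a u))
      where
        agrees-a : Agrees S S' a
        agrees-a = (λ _ ¬s'a → ¬s'a (from (S'≡a a) refl)) , (λ ¬sa _ → ¬sa sa)

    cosingleton-side : ∀ {a} → (∀ y → (¬ S' y) ⇔ y ≡ a) → ¬ S a → AtMostOne (∁ S)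
    cosingleton-side {a} ∁S'≡a ¬sa = a , λ u ¬su → to (∁S'≡a u) (proj₂ (agrees-everywhere agrees-a u) ¬su)
      where
        agrees-a : Agrees S S' a
        agrees-a = (λ sa → ⊥-elim (¬sa sa)) , (λ _ → from (∁S'≡a a) refl)

  trivialCut-sides : Connected G → ∀ {S} → Decidable S → TrivialCut G (Δ G S) → AtMostOne S ⊎ AtMostOne (∁ S)
  trivialCut-sides connected S? (_ , same , inj₁ (a , S'≡a)) with S? a
  ... | yes sa = inj₁ (singleton-side S'≡a sa)
    where open Propagation connected S? same
  ... | no ¬sa = inj₂ (singleton-side S'≡a ¬sa)
    where open Propagation connected (∁? S?) (Δ-∁ S? same)
  trivialCut-sides connected S? (_ , same , inj₂ (a , ∁S'≡a)) with S? a
  ... | yes sa = inj₁ (atMostOne-⊆ (λ s ¬s → ¬s s) (cosingleton-side ∁S'≡a (λ ¬sa → ¬sa sa)))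
    where open Propagation connected (∁? S?) (Δ-∁ S? same)
  ... | no ¬sa = inj₂ (cosingleton-side ∁S'≡a ¬sa)
    where open Propagation connected S? same

  module _ (connected : Connected G) {S : VSet n} (S? : Decidable S) (cut : TrivialCut G (Δ G S)) where

    trivialCut-singleton : ∀ {x y z} → y ≢ z → ¬ S y → ¬ S z → S x → ∀ u → S u → u ≡ x
    trivialCut-singleton y≢z ¬sy ¬sz sx with trivialCut-sides connected S? cut
    ... | inj₁ one = λ u su → atMostOne-unique one su sx
    ... | inj₂ one = ⊥-elim (y≢z (atMostOne-unique one ¬sy ¬sz))

    trivialCut-cosingleton : ∀ {x y z} → y ≢ z → S y → S z → ¬ S x → ∀ u → u ≢ x → S u
    trivialCut-cosingleton y≢z sy sz ¬sx with trivialCut-sides connected S? cut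
    ... | inj₁ one = ⊥-elim (y≢z (atMostOne-unique one sy sz))
    ... | inj₂ one = λ u u≢x → decidable-stable (S? u) (λ ¬su → u≢x (atMostOne-unique one ¬su ¬sx))

module _ {A : Set} (f : A → A) where
  open ≡-Reasoning

  iter-+ : ∀ j k a → iter f (j + k) a ≡ iter f j (iter f k a)
  iter-+ zero    k a = refl
  iter-+ (suc j) k a = cong f (iter-+ j k a)

  iter-sucʳ : ∀ k a → iter f k (f a) ≡ iter f (suc k) a
  iter-sucʳ zero    a = refl
  iter-sucʳ (suc k) a = cong f (iter-sucʳ k a)

  iter-fixed : ∀ {b} → f b ≡ b → ∀ k → iter f k b ≡ b
  iter-fixed fb≡b zero    = refl
  iter-fixed fb≡b (suc k) = trans (cong f (iter-fixed fb≡b k)) fb≡b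

  iter-stays-fixed : ∀ {a b j k} → f b ≡ b → iter f k a ≡ b → k ≤ j → iter f j a ≡ b
  iter-stays-fixed {a} {b} {j} {k} fb≡b reached k≤j = begin
    iter f j a                 ≡⟨ cong (λ i → iter f i a) (sym (m∸n+n≡m k≤j)) ⟩
    iter f (j ∸ k + k) a       ≡⟨ iter-+ (j ∸ k) k a ⟩
    iter f (j ∸ k) (iter f k a) ≡⟨ cong (iter f (j ∸ k)) reached ⟩
    iter f (j ∸ k) b           ≡⟨ iter-fixed fb≡b (j ∸ k) ⟩
    b                          ∎

  iter-periodic : ∀ {a k} → iter f (suc k) a ≡ a → ∀ m → iter f (m * suc k) a ≡ a
  iter-periodic         cycle zero    = refl
  iter-periodic {a} {k} cycle (suc m) = begin
    iter f (suc k + m * suc k) a          ≡⟨ iter-+ (suc k) (m * suc k) a ⟩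
    iter f (suc k) (iter f (m * suc k) a) ≡⟨ cong (iter f (suc k)) (iter-periodic cycle m) ⟩
    iter f (suc k) a                      ≡⟨ cycle ⟩
    a                                     ∎

module _ {n : ℕ} {G : Graph n} {r : Fin n} (T : RootedSpanningTree G r) where
  private
    p : Fin n → Fin n
    p = parent T

  cycle⇒root : ∀ {u k} → iter p (suc k) u ≡ u → u ≡ r
  cycle⇒root {u} {k} cycle with reaches-root T u
  ... | k₀ , reached = trans (sym (iter-periodic p cycle k₀))
                             (iter-stays-fixed p (parent-root T) reached (m≤m*n k₀ (suc k)))

  down-refl : ∀ x → down T x x
  down-refl x = 0 , refl

  down-trans : ∀ {x y u} → down T x u → down T y x → down T y u
  down-trans {x} {y} {u} (j , u↦x) (k , x↦y) =
    k + j , trans (iter-+ p k j u) (trans (cong (iter p k) u↦x) x↦y)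

  down-parent : ∀ {x u} → down T x (p u) → down T x u
  down-parent {x} {u} (k , pu↦x) = suc k , trans (sym (iter-sucʳ p k u)) pu↦x

  down-parent⁻ : ∀ {x u} → u ≢ x → down T x u → down T x (p u)
  down-parent⁻ u≢x (zero  , u≡x) = ⊥-elim (u≢x u≡x)
  down-parent⁻ {u = u} u≢x (suc k , u↦x) = k , trans (iter-sucʳ p k u) u↦x

  down-root : ∀ {x} → down T x r → x ≡ r
  down-root (k , r↦x) = trans (sym r↦x) (iter-fixed p (parent-root T) k)

  ¬down-parent : ∀ {x} → x ≢ r → ¬ down T x (p x)
  ¬down-parent {x} x≢r (k , px↦x) = x≢r (cycle⇒root {k = k} (trans (sym (iter-sucʳ p k x)) px↦x))

  child-of-root : ∀ {x z} → x ≢ r → p z ≡ r → down T x z → z ≡ x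
  child-of-root x≢r pz≡r (zero  , z≡x)  = z≡x
  child-of-root {z = z} x≢r pz≡r (suc k , z↦x) = ⊥-elim (x≢r (begin
    _                ≡⟨ sym z↦x ⟩
    iter p (suc k) z ≡⟨ sym (iter-sucʳ p k z) ⟩
    iter p k (p z)   ≡⟨ cong (iter p k) pz≡r ⟩
    iter p k r       ≡⟨ iter-fixed p (parent-root T) k ⟩
    r                ∎))
    where open ≡-Reasoning

  -- Beyond the first time the root is reached the chain stays at r, so the search is finite.
  down-within : ∀ {x u k₀} → iter p k₀ u ≡ r → down T x u → ∃ λ k → k < suc k₀ × iter p k u ≡ x
  down-within {k₀ = k₀} reached (k , u↦x) with k ≤? k₀
  ... | yes k≤k₀ = k , s≤s k≤k₀ , u↦x
  ... | no  k≰k₀ = k₀ , n<1+n k₀ ,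
                   trans reached (trans (sym (iter-stays-fixed p (parent-root T) reached (<⇒≤ (≰⇒> k≰k₀)))) u↦x)

  down? : ∀ x → Decidable (down T x)
  down? x u with reaches-root T u
  ... | k₀ , reached = map′ (λ (k , _ , u↦x) → k , u↦x) (down-within reached)
                            (anyUpTo? (λ k → iter p k u ≟ x) (suc k₀))

  sole-child : ∀ {x y} → x ≢ r → y ≢ r → InSubtree T y x →
               (∀ u → (down T x ∩ ∁ (down T y)) u → u ≡ x) →
               p y ≡ x × (∀ z → z ≢ r → p z ≡ x → z ≡ y)
  sole-child {x} {y} x≢r y≢r (py-below-x , y-below-x) only-x = py≡x , only-y
    where
      py≡x : p y ≡ x
      py≡x = only-x (p y) (py-below-x , ¬down-parent y≢r)

      only-y : ∀ z → z ≢ r → p z ≡ x → z ≡ y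
      only-y z z≢r pz≡x with z ≟ y
      ... | yes z≡y = z≡y
      ... | no  z≢y = ⊥-elim (¬down-parent x≢r (0 , trans (cong p (sym z≡x)) pz≡x))
        where
          z-not-below-y : ¬ down T y z
          z-not-below-y z-below-y = ¬down-parent y≢r
            (down-trans py-below-x (subst (down T y) pz≡x (down-parent⁻ z≢y z-below-y)))

          z≡x : z ≡ x
          z≡x = only-x z ((1 , pz≡x) , z-not-below-y)

  covered⇒parent≡root : ∀ {x y} → x ≢ r → (∀ u → u ≢ r → (down T x ∪ down T y) u) →
                        ¬ InSubtree T x y → p x ≡ r
  covered⇒parent≡root {x} x≢r covered x∉Ty with p x ≟ r
  ... | yes px≡r = px≡r
  ... | no  px≢r = [ (λ px-below-x → ⊥-elim (¬down-parent x≢r px-below-x))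
                   , (λ px-below-y → ⊥-elim (x∉Ty (px-below-y , down-parent px-below-y))) ]
                   (covered (p x) px≢r)

module _ {n : ℕ} {G : Graph n} (connected : Connected G) {r : Fin n} (T : RootedSpanningTree G r) where

  trivial-difference-cut : ∀ {x y} → x ≢ r → y ≢ r → InSubtree T y x →
    TrivialCut G (Δ G (down T x ∩ ∁ (down T y))) →
    parent T y ≡ x × (∀ z → z ≢ r → parent T z ≡ x → z ≡ y)
  trivial-difference-cut {x} {y} x≢r y≢r y∈Tx@(py-below-x , _) cut =
    sole-child T x≢r y≢r y∈Tx
      (trivialCut-singleton G connected (down? T x ∩? ∁? (down? T y)) cut y≢r y∉S r∉S x∈S)
    where
      y∉S : ¬ (down T x ∩ ∁ (down T y)) y
      y∉S (_ , y-not-below-y) = y-not-below-y (down-refl T y)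

      r∉S : ¬ (down T x ∩ ∁ (down T y)) r
      r∉S (r-below-x , _) = x≢r (down-root T r-below-x)

      x∈S : (down T x ∩ ∁ (down T y)) x
      x∈S = down-refl T x , λ x-below-y → ¬down-parent T y≢r (down-trans T py-below-x x-below-y)

  trivial-union-cut : ∀ {x y} → x ≢ r → y ≢ r → x ≢ y → Independent T x y →
    TrivialCut G (Δ G (down T x ∪ down T y)) →
    Incident T r x × Incident T r y × (∀ z → z ≢ r → Incident T r z → z ≡ x ⊎ z ≡ y)
  trivial-union-cut {x} {y} x≢r y≢r x≢y independent cut =
    inj₁ (covered⇒parent≡root T x≢r covered (independent ∘ inj₂)) ,
    inj₁ (covered⇒parent≡root T y≢r (λ u → swap ∘ covered u) (independent ∘ inj₁)) ,
    child-of-root-is-x-or-y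
    where
      covered : ∀ u → u ≢ r → (down T x ∪ down T y) u
      covered = trivialCut-cosingleton G connected (down? T x ∪? down? T y) cut x≢y
        (inj₁ (down-refl T x)) (inj₂ (down-refl T y))
        [ x≢r ∘ down-root T , y≢r ∘ down-root T ]

      child-of-root-is-x-or-y : ∀ z → z ≢ r → Incident T r z → z ≡ x ⊎ z ≡ y
      child-of-root-is-x-or-y z z≢r (inj₂ z≡r)  = ⊥-elim (z≢r z≡r)
      child-of-root-is-x-or-y z z≢r (inj₁ pz≡r) =
        [ inj₁ ∘ child-of-root T x≢r pz≡r , inj₂ ∘ child-of-root T y≢r pz≡r ] (covered z z≢r)

proposition8 : ∀ (n : ℕ) (G : Graph n) → Connected G →
    ∀ (r : Fin n) (T : RootedSpanningTree G r) →
    ∀ (x y : Fin n) → x ≢ r → y ≢ r → x ≢ y →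
    ∀ (S : VSet n) → IsCutSide T x y S → TrivialCut G (Δ G S) →
    (Independent T x y →
      Incident T r x × Incident T r y ×
      (∀ z → z ≢ r → Incident T r z → z ≡ x ⊎ z ≡ y)) ×
    (Descendant T x y →
      ∃ λ v →
        (x ≡ v × parent T y ≡ v × (∀ z → z ≢ r → parent T z ≡ v → z ≡ y)) ⊎
        (y ≡ v × parent T x ≡ v × (∀ z → z ≢ r → parent T z ≡ v → z ≡ x)))
proposition8 n G connected r T x y x≢r y≢r x≢y _ (desc₁ y∈Tx) cut =
    (λ independent → ⊥-elim (independent (inj₁ y∈Tx)))
  , (λ _ → x , inj₁ (refl , trivial-difference-cut connected T x≢r y≢r y∈Tx cut))
proposition8 n G connected r T x y x≢r y≢r x≢y _ (desc₂ x∈Ty) cut =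
    (λ independent → ⊥-elim (independent (inj₂ x∈Ty)))
  , (λ _ → y , inj₂ (refl , trivial-difference-cut connected T y≢r x≢r x∈Ty cut))
proposition8 n G connected r T x y x≢r y≢r x≢y _ (indep independent) cut =
    (λ _ → trivial-union-cut connected T x≢r y≢r x≢y independent cut)
  , (λ descendant → ⊥-elim (independent descendant))
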